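{- The set $\mathcal{R}_p(1)$, with the composition $\rho\rho':=\rho*\rho'$ taken modulo $\approx$, is a group isomorphic to the symmetric group $\mathrm{S}_4$.
   Context: Language: variables (including $e$), constants $0,1$, connectives $\neg,\vee$ (others as abbreviations), modal operator $\lozenge$. $\mathbf{E}$ is the smallest set of formulas containing all propositional tautologies and closed under modus ponens, uniform substitution and RE (from $\varphi\leftrightarrow\psi$ infer $\lozenge\varphi\leftrightarrow\lozenge\psi$). $\varphi\approx\psi$ means $\vdash_{\mathbf{E}}\varphi\leftrightarrow\psi$. A uniform replacement (UR) is a formula $\rho(e)$ of modal degree at most 1 in the single variable $e$. For any formula $\varphi$, $\varphi*\rho$ is defined recursively: $0*\rho=0$, $1*\rho=1$, variables are unchanged, $(\psi\vee\theta)*\rho=(\psi*\rho)\vee(\theta*\rho)$, $(\neg\psi)*\rho=\neg(\psi*\rho)$, $(\lozenge\psi)*\rho=\rho(\psi*\rho)$ (substitute $\psi*\rho$ for $e$ in $\rho(e)$). Composition: $\rho\rho':=\rho*\rho'$ (the UR $\rho'$ applied to the formula $\rho(e)$). $\mathcal{R}_p(1)$ is the set of 24 URs: all $\lambda\leftrightarrow\tau$ with $\lambda\in\{\lozenge e,\neg\lozenge e\}$ and $\tau\in\{1,e,e\vee\lozenge\neg e,e\vee\neg\lozenge\neg e,\neg e\vee\lozenge\neg e,\neg e\vee\neg\lozenge\neg e\}$, together with all $\lambda\leftrightarrow\tau$ with $\lambda\in\{\lozenge\neg e,\neg\lozenge\neg e\}$ and $\tau\in\{1,e,e\vee\lozenge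 e,e\vee\neg\lozenge e,\neg e\vee\lozenge e,\neg e\vee\neg\lozenge e\}$. -}

module Defs where

open import Data.Nat using (ℕ; zero; suc)
open import Data.Bool using (Bool; true; false; not; _∨_)
open import Data.Fin using (Fin)
open import Data.Vec using (Vec; []; _∷_; _++_; lookup; map; concat)
open import Relation.Binary.PropositionalEquality using (_≡_)

infixr 6 _∨'_

data Fm : Set where
  var  : ℕ → Fm
  𝟘 𝟙  : Fm
  ¬'_  : Fm → Fm
  _∨'_ : Fm → Fm → Fm
  ◇_   : Fm → Fm

e : Fm
e = var 0

_∧'_ : Fm → Fm → Fm
φ ∧' ψ = ¬' ((¬' φ) ∨' (¬' ψ))

_⇒_ : Fm → Fm → Fm
φ ⇒ ψ = (¬' φ) ∨' ψ

_⇔_ : Fm → Fm → Fm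
φ ⇔ ψ = (φ ⇒ ψ) ∧' (ψ ⇒ φ)

-- Propositional tautologies: true under every Boolean assignment to the
-- variables and to the modal subformulas ◇ψ (treated as atoms).

eval : (ℕ → Bool) → (Fm → Bool) → Fm → Bool
eval a w (var n)  = a n
eval a w 𝟘        = false
eval a w 𝟙        = true
eval a w (¬' φ)   = not (eval a w φ)
eval a w (φ ∨' ψ) = eval a w φ ∨ eval a w ψ
eval a w (◇ φ)    = w φ

Tautology : Fm → Set
Tautology φ = (a : ℕ → Bool) (w : Fm → Bool) → eval a w φ ≡ true

sub : (ℕ → Fm) → Fm → Fm
sub σ (var n)  = σ n
sub σ 𝟘        = 𝟘
sub σ 𝟙        = 𝟙
sub σ (¬' φ)   = ¬' sub σ φ
sub σ (φ ∨' ψ) = sub σ φ ∨' sub σ ψ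
sub σ (◇ φ)    = ◇ sub σ φ

data ⊢E_ : Fm → Set where
  taut : ∀ {φ} → Tautology φ → ⊢E φ
  mp   : ∀ {φ ψ} → ⊢E φ → ⊢E (φ ⇒ ψ) → ⊢E ψ
  usub : ∀ {φ} (σ : ℕ → Fm) → ⊢E φ → ⊢E (sub σ φ)
  re   : ∀ {φ ψ} → ⊢E (φ ⇔ ψ) → ⊢E ((◇ φ) ⇔ (◇ ψ))

infix 4 _≈_
_≈_ : Fm → Fm → Set
φ ≈ ψ = ⊢E (φ ⇔ ψ)

_[_/e] : Fm → Fm → Fm
ρ [ χ /e] = sub σ ρ
  where
  σ : ℕ → Fm
  σ zero    = χ
  σ (suc n) = var (suc n)

infixl 7 _*_
_*_ : Fm → Fm → Fm
var n    * ρ = var n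
𝟘        * ρ = 𝟘
𝟙        * ρ = 𝟙
(¬' φ)   * ρ = ¬' (φ * ρ)
(φ ∨' ψ) * ρ = (φ * ρ) ∨' (ψ * ρ)
(◇ φ)    * ρ = ρ [ φ * ρ /e]

_·_ : Fm → Fm → Fm
ρ · ρ' = ρ * ρ'

λA : Vec Fm 2
λA = ◇ e ∷ (¬' ◇ e) ∷ []

τA : Vec Fm 6
τA = 𝟙 ∷ e ∷ (e ∨' ◇ (¬' e)) ∷ (e ∨' (¬' ◇ (¬' e)))
   ∷ ((¬' e) ∨' ◇ (¬' e)) ∷ ((¬' e) ∨' (¬' ◇ (¬' e))) ∷ []

λB : Vec Fm 2
λB = ◇ (¬' e) ∷ (¬' ◇ (¬' e)) ∷ []

τB : Vec Fm 6
τB = 𝟙 ∷ e ∷ (e ∨' ◇ e) ∷ (e ∨' (¬' ◇ e))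
   ∷ ((¬' e) ∨' ◇ e) ∷ ((¬' e) ∨' (¬' ◇ e)) ∷ []

pairs : Vec Fm 2 → Vec Fm 6 → Vec Fm 12
pairs ls ts = concat (map (λ l → map (λ t → l ⇔ t) ts) ls)

Rp1 : Vec Fm 24
Rp1 = pairs λA τA ++ pairs λB τB

Rp : Fin 24 → Fm
Rp = lookup Rp1

-- Evaluate formulas at a single world whose neighbourhood structure is a function
-- N : Bool → Bool (◇φ holds iff N sends the truth value of φ to true); E is sound for
-- these models. A uniform replacement ρ turns N into x ↦ ⟦ ρ ⟧ N (e := x), and
-- φ * ρ under N means φ under the transformed N, so composing replacements composes
-- these transformations. Each element of R_p(1) permutes the four functions Bool → Bool,
-- different elements permute them differently (so they are not ≈), and all 24
-- permutations occur. That the composite of two elements is ≈ to the element acting as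
-- the composite permutation is a propositional check over e, ◇e, ◇¬e, ◇¬¬e, given
-- ◇¬¬e ↔ ◇e from RE.
module Submission where

open import Defs
open import Data.Bool using (Bool; true; false; not; _∨_; _∧_; T; if_then_else_)
open import Data.Bool.Properties using (T?; T-∧; T-≡)
open import Data.Fin using (Fin; zero; suc; #_; _≟_)
open import Data.Fin.Properties using (all?; any?)
open import Data.Fin.Permutation
  using (Permutation; Permutation′; permutation; flip; _∘ₚ_; _⟨$⟩ʳ_; _⟨$⟩ˡ_; inverseˡ; inverseʳ)
  renaming (_≈_ to _≈ₚ_)
open import Data.List using (List; []; _∷_)
open import Data.List.Relation.Unary.All using (All; []; _∷_)
open import Data.Maybe using (Maybe; just; nothing; fromMaybe; zipWith)
import Data.Maybe as Maybe
open import Data.Nat using (ℕ; zero; suc; _≡ᵇ_)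
open import Data.Nat.Properties using (≡ᵇ⇒≡)
open import Data.Product using (Σ; ∃; _×_; _,_; proj₁; proj₂)
open import Data.Sum using (_⊎_; inj₁; inj₂)
open import Data.Vec using ([]; _∷_; lookup; tabulate)
open import Data.Vec.Properties using (lookup∘tabulate)
open import Function using (_∘_; const; Injection; StrictlyInverseˡ; StrictlyInverseʳ)
open import Function.Bundles using (module Equivalence)
open import Function.Properties.Inverse using (↔⇒↣)
open import Relation.Nullary using (¬_; contradiction)
open import Relation.Nullary.Decidable using (yes; no; from-yes; ¬?; _×-dec_; _⊎-dec_; _→-dec_)
open import Relation.Binary.PropositionalEquality
  using (_≡_; _≗_; refl; sym; trans; cong; cong₂; module ≡-Reasoning)
open ≡-Reasoning

⟦_⟧ : Fm → (Bool → Bool) → (ℕ → Bool) → Bool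
⟦ var n ⟧    N a = a n
⟦ 𝟘 ⟧        N a = false
⟦ 𝟙 ⟧        N a = true
⟦ ¬' φ ⟧     N a = not (⟦ φ ⟧ N a)
⟦ φ ∨' ψ ⟧   N a = ⟦ φ ⟧ N a ∨ ⟦ ψ ⟧ N a
⟦ ◇ φ ⟧      N a = N (⟦ φ ⟧ N a)

⟦⟧-cong : ∀ φ {N M a b} → N ≗ M → a ≗ b → ⟦ φ ⟧ N a ≡ ⟦ φ ⟧ M b
⟦⟧-cong (var n)  N≗M a≗b = a≗b n
⟦⟧-cong 𝟘        N≗M a≗b = refl
⟦⟧-cong 𝟙        N≗M a≗b = refl
⟦⟧-cong (¬' φ)   N≗M a≗b = cong not (⟦⟧-cong φ N≗M a≗b)
⟦⟧-cong (φ ∨' ψ) N≗M a≗b = cong₂ _∨_ (⟦⟧-cong φ N≗M a≗b) (⟦⟧-cong ψ N≗M a≗b)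
⟦⟧-cong (◇ φ) {M = M} N≗M a≗b = trans (N≗M _) (cong M (⟦⟧-cong φ N≗M a≗b))

eval-⟦⟧ : ∀ φ N a → eval a (λ ψ → N (⟦ ψ ⟧ N a)) φ ≡ ⟦ φ ⟧ N a
eval-⟦⟧ (var n)  N a = refl
eval-⟦⟧ 𝟘        N a = refl
eval-⟦⟧ 𝟙        N a = refl
eval-⟦⟧ (¬' φ)   N a = cong not (eval-⟦⟧ φ N a)
eval-⟦⟧ (φ ∨' ψ) N a = cong₂ _∨_ (eval-⟦⟧ φ N a) (eval-⟦⟧ ψ N a)
eval-⟦⟧ (◇ φ)    N a = refl

⟦sub⟧ : ∀ σ φ N a → ⟦ sub σ φ ⟧ N a ≡ ⟦ φ ⟧ N (λ n → ⟦ σ n ⟧ N a)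
⟦sub⟧ σ (var n)  N a = refl
⟦sub⟧ σ 𝟘        N a = refl
⟦sub⟧ σ 𝟙        N a = refl
⟦sub⟧ σ (¬' φ)   N a = cong not (⟦sub⟧ σ φ N a)
⟦sub⟧ σ (φ ∨' ψ) N a = cong₂ _∨_ (⟦sub⟧ σ φ N a) (⟦sub⟧ σ ψ N a)
⟦sub⟧ σ (◇ φ)    N a = cong N (⟦sub⟧ σ φ N a)

⟦⇔⟧-sound : ∀ φ ψ N a → ⟦ φ ⇔ ψ ⟧ N a ≡ true → ⟦ φ ⟧ N a ≡ ⟦ ψ ⟧ N a
⟦⇔⟧-sound φ ψ N a h with ⟦ φ ⟧ N a | ⟦ ψ ⟧ N a
... | true  | true  = refl
... | false | false = refl

⟦⇔⟧-complete : ∀ φ ψ N a → ⟦ φ ⟧ N a ≡ ⟦ ψ ⟧ N a → ⟦ φ ⇔ ψ ⟧ N a ≡ true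
⟦⇔⟧-complete φ ψ N a h with ⟦ φ ⟧ N a | ⟦ ψ ⟧ N a
... | true  | true  = refl
... | false | false = refl

sound : ∀ {φ} → ⊢E φ → ∀ N a → ⟦ φ ⟧ N a ≡ true
sound {φ} (taut t) N a = trans (sym (eval-⟦⟧ φ N a)) (t a _)
sound (mp {φ} ⊢φ ⊢φ⇒ψ) N a with ⟦ φ ⟧ N a | sound ⊢φ N a | sound ⊢φ⇒ψ N a
... | true | refl | ψ-holds = ψ-holds
sound (usub {φ} σ ⊢φ) N a = trans (⟦sub⟧ σ φ N a) (sound ⊢φ N _)
sound (re {φ} {ψ} ⊢φ⇔ψ) N a =
  ⟦⇔⟧-complete (◇ φ) (◇ ψ) N a (cong N (⟦⇔⟧-sound φ ψ N a (sound ⊢φ⇔ψ N a)))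

≈-sound : ∀ {φ ψ} → φ ≈ ψ → ∀ N a → ⟦ φ ⟧ N a ≡ ⟦ ψ ⟧ N a
≈-sound {φ} {ψ} φ≈ψ N a = ⟦⇔⟧-sound φ ψ N a (sound φ≈ψ N a)

_▸_ : Bool → (ℕ → Bool) → ℕ → Bool
(x ▸ a) zero    = x
(x ▸ a) (suc n) = a (suc n)

⟦[/e]⟧ : ∀ ρ χ N a → ⟦ ρ [ χ /e] ⟧ N a ≡ ⟦ ρ ⟧ N (⟦ χ ⟧ N a ▸ a)
⟦[/e]⟧ ρ χ N a = trans (⟦sub⟧ _ ρ N a) (⟦⟧-cong ρ (λ _ → refl) λ { zero → refl ; (suc n) → refl })

transform : Fm → (Bool → Bool) → (ℕ → Bool) → Bool → Bool
transform ρ N a x = ⟦ ρ ⟧ N (x ▸ a)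

⟦*⟧ : ∀ φ ρ N a → ⟦ φ * ρ ⟧ N a ≡ ⟦ φ ⟧ (transform ρ N a) a
⟦*⟧ (var n)  ρ N a = refl
⟦*⟧ 𝟘        ρ N a = refl
⟦*⟧ 𝟙        ρ N a = refl
⟦*⟧ (¬' φ)   ρ N a = cong not (⟦*⟧ φ ρ N a)
⟦*⟧ (φ ∨' ψ) ρ N a = cong₂ _∨_ (⟦*⟧ φ ρ N a) (⟦*⟧ ψ ρ N a)
⟦*⟧ (◇ φ)    ρ N a = trans (⟦[/e]⟧ ρ (φ * ρ) N a) (cong (transform ρ N a) (⟦*⟧ φ ρ N a))

transform-· : ∀ ρ ρ′ N a x → transform (ρ · ρ′) N a x ≡ transform ρ (transform ρ′ N a) a x
transform-· ρ ρ′ N a x = trans (⟦*⟧ ρ ρ′ N (x ▸ a))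
  (⟦⟧-cong ρ (λ y → ⟦⟧-cong ρ′ (λ _ → refl) λ { zero → refl ; (suc n) → refl }) (λ _ → refl))

nbhd : Fin 4 → Bool → Bool
nbhd zero                   x = x
nbhd (suc zero)             x = not x
nbhd (suc (suc zero))       x = true
nbhd (suc (suc (suc zero))) x = false

code : Bool → Bool → Fin 4
code true  false = # 0
code false true  = # 1
code true  true  = # 2
code false false = # 3

index : (Bool → Bool) → Fin 4
index g = code (g true) (g false)

nbhd-index : ∀ g x → nbhd (index g) x ≡ g x
nbhd-index g true  with g true | g false
... | true  | true  = refl
... | true  | false = refl
... | false | true  = refl
... | false | false = refl
nbhd-index g false with g true | g false
... | true  | true  = refl
... | true  | false = refl
... | false | true  = refl
... | false | false = refl

index-cong : ∀ {g h} → g ≗ h → index g ≡ index h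
index-cong g≗h = cong₂ code (g≗h true) (g≗h false)

act : Fm → Fin 4 → Fin 4
act ρ k = index (transform ρ (nbhd k) (const false))

act-· : ∀ ρ ρ′ k → act (ρ · ρ′) k ≡ act ρ (act ρ′ k)
act-· ρ ρ′ k = index-cong λ x → trans (transform-· ρ ρ′ (nbhd k) (const false) x)
  (⟦⟧-cong ρ (λ y → sym (nbhd-index (transform ρ′ (nbhd k) (const false)) y)) (λ _ → refl))

act-≈ : ∀ {ρ ρ′} → ρ ≈ ρ′ → act ρ ≗ act ρ′
act-≈ ρ≈ρ′ k = index-cong λ x → ≈-sound ρ≈ρ′ (nbhd k) (x ▸ const false)

infix 4 _==_
_==_ : Fm → Fm → Bool
var m    == var n      = m ≡ᵇ n
𝟘        == 𝟘          = true
𝟙        == 𝟙          = true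
(¬' φ)   == (¬' ψ)     = φ == ψ
(φ ∨' ψ) == (φ′ ∨' ψ′) = (φ == φ′) ∧ (ψ == ψ′)
(◇ φ)    == (◇ ψ)      = φ == ψ
_        == _          = false

==⇒≡ : ∀ φ ψ → T (φ == ψ) → φ ≡ ψ
==⇒≡ (var m)  (var n)    h = cong var (≡ᵇ⇒≡ m n h)
==⇒≡ 𝟘        𝟘          h = refl
==⇒≡ 𝟙        𝟙          h = refl
==⇒≡ (¬' φ)   (¬' ψ)     h = cong ¬'_ (==⇒≡ φ ψ h)
==⇒≡ (φ ∨' ψ) (φ′ ∨' ψ′) h = cong₂ _∨'_ (==⇒≡ φ φ′ (proj₁ (Equivalence.to T-∧ h)))
                                         (==⇒≡ ψ ψ′ (proj₂ (Equivalence.to T-∧ h)))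
==⇒≡ (◇ φ)    (◇ ψ)      h = cong ◇_ (==⇒≡ φ ψ h)

lookupAtom : List (Fm × Bool) → Fm → Maybe Bool
lookupAtom []            ψ = nothing
lookupAtom ((χ , b) ∷ α) ψ = if ψ == χ then just b else lookupAtom α ψ

-- Variables and ◇-formulas are the atoms; an atom missing from α leaves the value unknown.
peval : List (Fm × Bool) → Fm → Maybe Bool
peval α 𝟘        = just false
peval α 𝟙        = just true
peval α (¬' φ)   = Maybe.map not (peval α φ)
peval α (φ ∨' ψ) = zipWith _∨_ (peval α φ) (peval α ψ)
peval α φ        = lookupAtom α φ

validOver : List Fm → List (Fm × Bool) → Fm → Bool
validOver []       α φ = fromMaybe false (peval α φ)
validOver (χ ∷ χs) α φ = validOver χs ((χ , true) ∷ α) φ ∧ validOver χs ((χ , false) ∷ α) φ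

module _ (a : ℕ → Bool) (w : Fm → Bool) where

  Agrees : List (Fm × Bool) → Set
  Agrees = All λ (χ , b) → eval a w χ ≡ b

  lookupAtom-sound : ∀ {α} ψ {v} → Agrees α → lookupAtom α ψ ≡ just v → eval a w ψ ≡ v
  lookupAtom-sound {(χ , b) ∷ α} ψ (χ↦b ∷ agrees) h with ψ == χ in eq
  ... | true with refl ← h = trans (cong (eval a w) (==⇒≡ ψ χ (Equivalence.from T-≡ eq))) χ↦b
  ... | false = lookupAtom-sound ψ agrees h

  peval-sound : ∀ {α} φ {v} → Agrees α → peval α φ ≡ just v → eval a w φ ≡ v
  peval-sound 𝟘 agrees refl = refl
  peval-sound 𝟙 agrees refl = refl
  peval-sound {α} (¬' φ) agrees h with peval α φ in eq
  ... | just b with refl ← h = cong not (peval-sound φ agrees eq)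
  peval-sound {α} (φ ∨' ψ) agrees h with peval α φ in eqφ | peval α ψ in eqψ
  ... | just b | just c with refl ← h = cong₂ _∨_ (peval-sound φ agrees eqφ) (peval-sound ψ agrees eqψ)
  peval-sound (var n) agrees h = lookupAtom-sound (var n) agrees h
  peval-sound (◇ φ)   agrees h = lookupAtom-sound (◇ φ) agrees h

  validOver-sound : ∀ χs {α} φ → Agrees α → T (validOver χs α φ) → eval a w φ ≡ true
  validOver-sound [] {α} φ agrees h with peval α φ in eq
  ... | just true = peval-sound φ agrees eq
  validOver-sound (χ ∷ χs) φ agrees h with eval a w χ in eq
  ... | true  = validOver-sound χs φ (eq ∷ agrees) (proj₁ (Equivalence.to T-∧ h))
  ... | false = validOver-sound χs φ (eq ∷ agrees) (proj₂ (Equivalence.to T-∧ h))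

tautology-over : ∀ χs φ → T (validOver χs [] φ) → Tautology φ
tautology-over χs φ h a w = validOver-sound a w χs φ [] h

private variable m n o : ℕ

flip-injective : {π σ : Permutation m n} → flip π ≈ₚ flip σ → π ≈ₚ σ
flip-injective {π = π} {σ = σ} π⁻¹≈σ⁻¹ x = begin
  π ⟨$⟩ʳ x                      ≡⟨ cong (π ⟨$⟩ʳ_) (sym (inverseˡ σ)) ⟩
  π ⟨$⟩ʳ (σ ⟨$⟩ˡ (σ ⟨$⟩ʳ x))    ≡⟨ cong (π ⟨$⟩ʳ_) (sym (π⁻¹≈σ⁻¹ (σ ⟨$⟩ʳ x))) ⟩
  π ⟨$⟩ʳ (π ⟨$⟩ˡ (σ ⟨$⟩ʳ x))    ≡⟨ inverseʳ π ⟩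
  σ ⟨$⟩ʳ x                      ∎

flip-∘ₚ : {π : Permutation m n} {σ : Permutation n o} {τ : Permutation m o} →
          τ ≈ₚ π ∘ₚ σ → flip τ ≈ₚ flip σ ∘ₚ flip π
flip-∘ₚ {π = π} {σ = σ} {τ = τ} τ≈πσ x = begin
  τ ⟨$⟩ˡ x                                       ≡⟨ cong (τ ⟨$⟩ˡ_) (sym σπ-π⁻¹σ⁻¹) ⟩
  τ ⟨$⟩ˡ (σ ⟨$⟩ʳ (π ⟨$⟩ʳ (π ⟨$⟩ˡ (σ ⟨$⟩ˡ x))))   ≡⟨ cong (τ ⟨$⟩ˡ_) (sym (τ≈πσ _)) ⟩
  τ ⟨$⟩ˡ (τ ⟨$⟩ʳ (π ⟨$⟩ˡ (σ ⟨$⟩ˡ x)))            ≡⟨ inverseˡ τ ⟩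
  π ⟨$⟩ˡ (σ ⟨$⟩ˡ x)                              ∎
  where
  σπ-π⁻¹σ⁻¹ : σ ⟨$⟩ʳ (π ⟨$⟩ʳ (π ⟨$⟩ˡ (σ ⟨$⟩ˡ x))) ≡ x
  σπ-π⁻¹σ⁻¹ = trans (cong (σ ⟨$⟩ʳ_) (inverseʳ π)) (inverseʳ σ)

-- Returns the junk value y when y has no preimage; act (Rp i) is onto, so this never happens.
preimage : ∀ {n} → (Fin n → Fin n) → Fin n → Fin n
preimage f y with any? (λ x → f x ≟ y)
... | yes (x , _) = x
... | no _        = y

-- The fallback value i never occurs: every value is certified by composite-≈ below.
composite : Fin 24 → Fin 24 → Fin 24
composite i j with any? (λ k → all? λ x → act (Rp k) x ≟ act (Rp i) (act (Rp j) x))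
... | yes (k , _) = k
... | no _        = i

◇¬¬e⇔◇e : ⊢E ((◇ ¬' ¬' e) ⇔ (◇ e))
◇¬¬e⇔◇e = re (taut (tautology-over (e ∷ []) ((¬' ¬' e) ⇔ e) _))

modalAtoms : List Fm
modalAtoms = e ∷ ◇ e ∷ ◇ ¬' e ∷ ◇ ¬' ¬' e ∷ []

composite-claim : Fin 24 → Fin 24 → Fm
composite-claim i j = ((◇ ¬' ¬' e) ⇔ (◇ e)) ⇒ ((Rp i · Rp j) ⇔ Rp (composite i j))

-- Finite facts checked by evaluation; opaque so that their uses do not re-evaluate them.
opaque
  act-inverseˡ : ∀ i → StrictlyInverseˡ _≡_ (act (Rp i)) (preimage (act (Rp i)))
  act-inverseˡ = from-yes (all? λ i → all? λ x → act (Rp i) (preimage (act (Rp i)) x) ≟ x)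

  act-inverseʳ : ∀ i → StrictlyInverseʳ _≡_ (act (Rp i)) (preimage (act (Rp i)))
  act-inverseʳ = from-yes (all? λ i → all? λ x → preimage (act (Rp i)) (act (Rp i) x) ≟ x)

  act-injective : ∀ i j → act (Rp i) ≗ act (Rp j) → i ≡ j
  act-injective = from-yes (all? λ i → all? λ j →
    all? (λ x → act (Rp i) x ≟ act (Rp j) x) →-dec (i ≟ j))

  composite-claim-valid : ∀ i j → T (validOver modalAtoms [] (composite-claim i j))
  composite-claim-valid = from-yes (all? λ i → all? λ j →
    T? (validOver modalAtoms [] (composite-claim i j)))

  repeating-or-realised : ∀ a b c d → let v = a ∷ b ∷ c ∷ d ∷ [] in
      (∃ λ x → ∃ λ y → ¬ x ≡ y × lookup v x ≡ lookup v y)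
    ⊎ (∃ λ i → ∀ x → act (Rp i) x ≡ lookup v x)
  repeating-or-realised = from-yes (all? λ a → all? λ b → all? λ c → all? λ d →
    let v = a ∷ b ∷ c ∷ d ∷ [] in
          any? (λ x → any? λ y → ¬? (x ≟ y) ×-dec (lookup v x ≟ lookup v y))
    ⊎-dec any? (λ i → all? λ x → act (Rp i) x ≟ lookup v x))

composite-≈ : ∀ i j → Rp i · Rp j ≈ Rp (composite i j)
composite-≈ i j = mp ◇¬¬e⇔◇e
  (taut (tautology-over modalAtoms (composite-claim i j) (composite-claim-valid i j)))

actₚ : Fin 24 → Permutation′ 4
actₚ i = permutation (act (Rp i)) (preimage (act (Rp i))) (act-inverseˡ i) (act-inverseʳ i)

actₚ-composite : ∀ i j → actₚ (composite i j) ≈ₚ actₚ j ∘ₚ actₚ i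
actₚ-composite i j x = trans (sym (act-≈ (composite-≈ i j) x)) (act-· (Rp i) (Rp j) x)

actₚ-surjective : ∀ (π : Permutation′ 4) → ∃ λ i → actₚ i ≈ₚ π
actₚ-surjective π with repeating-or-realised (π ⟨$⟩ʳ # 0) (π ⟨$⟩ʳ # 1) (π ⟨$⟩ʳ # 2) (π ⟨$⟩ʳ # 3)
... | inj₂ (i , act≗π) = i , λ x → trans (act≗π x) (lookup∘tabulate (π ⟨$⟩ʳ_) x)
... | inj₁ (x , y , x≢y , πx≡πy) = contradiction (Injection.injective (↔⇒↣ π) (begin
  π ⟨$⟩ʳ x                        ≡⟨ sym (lookup∘tabulate (π ⟨$⟩ʳ_) x) ⟩
  lookup (tabulate (π ⟨$⟩ʳ_)) x   ≡⟨ πx≡πy ⟩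
  lookup (tabulate (π ⟨$⟩ʳ_)) y   ≡⟨ lookup∘tabulate (π ⟨$⟩ʳ_) y ⟩
  π ⟨$⟩ʳ y                        ∎)) x≢y

theorem11 : Σ (Fin 24 → Permutation′ 4) λ φ →
      ((i j : Fin 24) → Rp i ≈ Rp j → i ≡ j)
    × ((i j : Fin 24) → Σ (Fin 24) λ k → (Rp i · Rp j ≈ Rp k) × (φ k ≈ₚ (φ i ∘ₚ φ j)))
    × ((i j : Fin 24) → φ i ≈ₚ φ j → i ≡ j)
    × ((π : Permutation′ 4) → Σ (Fin 24) λ i → φ i ≈ₚ π)
theorem11 = φ
  , (λ i j Rpi≈Rpj → act-injective i j (act-≈ Rpi≈Rpj))
  , (λ i j → composite i j , composite-≈ i j , flip-∘ₚ {π = actₚ j} {σ = actₚ i} {τ = actₚ (composite i j)} (actₚ-composite i j))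
  , (λ i j φi≈φj → act-injective i j (flip-injective {π = actₚ i} {σ = actₚ j} φi≈φj))
  , λ π → let (i , actₚi≈π⁻¹) = actₚ-surjective (flip π) in i , flip-injective {π = φ i} {σ = π} actₚi≈π⁻¹
  where
  -- ρ ↦ act ρ turns · into ordinary composition, but ∘ₚ is diagrammatic: hence the inverse.
  φ : Fin 24 → Permutation′ 4
  φ = flip ∘ actₚ
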